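{- Let $n,k$ be integers with $n\ge 3$ and $1\le k<n/2$. If the double generalized Petersen graph $\mathrm{DP}(n,k)$ is $[1,\lambda,8]$-cycle regular for some integer $\lambda$, then $\mathrm{DP}(n,k)$ is isomorphic to $\mathrm{DP}(5,2)$ or to $\mathrm{DP}(10,2)$.
   Context: For integers $n\ge 3$ and $1\le k<n/2$, the double generalized Petersen graph $\mathrm{DP}(n,k)$ has vertex set $\{u_i,w_i,x_i,y_i : i=0,\dots,n-1\}$ and edge set consisting of the outer edges $u_iu_{i+1}$ and $x_ix_{i+1}$, the inner edges $w_iy_{i+k}$ and $y_iw_{i+k}$, and the spoke edges $u_iw_i$ and $x_iy_i$, for $i=0,\dots,n-1$, with subscripts taken modulo $n$. For integers $l,\lambda,m$, a simple graph is $[l,\lambda,m]$-cycle regular if every path on $l+1$ vertices belongs to exactly $\lambda$ different cycles of length $m$; in particular $[1,\lambda,8]$-cycle regular means every edge lies on exactly $\lambda$ distinct $8$-cycles. -}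

module Defs where

open import Data.Nat using (ℕ; _+_; _≡ᵇ_)
open import Data.Fin using (Fin; toℕ)
open import Data.Fin.Properties using () renaming (_≟_ to _≟F_)
open import Data.Bool using (Bool; true; false; _∧_; _∨_; not)
open import Data.Product using (Σ; _×_; _,_)
open import Data.List using (List; []; _∷_)
open import Data.Vec using (Vec; toList) renaming ([] to []ᵥ; _∷_ to _∷ᵥ_)
open import Data.Bool using (T)
open import Relation.Nullary.Decidable using (⌊_⌋)
open import Relation.Binary.PropositionalEquality using (_≡_)
open import Function.Bundles using (_↔_; Inverse)

data Kind : Set where
  U W X Y : Kind

_≟K_ : Kind → Kind → Bool
U ≟K U = true
W ≟K W = true
X ≟K X = true
Y ≟K Y = true
_ ≟K _ = false

Vertex : ℕ → Set
Vertex n = Kind × Fin n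

eqV : ∀ {n} → Vertex n → Vertex n → Bool
eqV (c , i) (d , j) = (c ≟K d) ∧ ⌊ i ≟F j ⌋

-- For 0 ≤ i, j < n and 0 ≤ s < n:  stepB n s i j  ⇔  j ≡ i + s (mod n).
stepB : ℕ → ℕ → ℕ → ℕ → Bool
stepB n s i j = (i + s ≡ᵇ j) ∨ (i + s ≡ᵇ j + n)

nearB : ℕ → ℕ → ℕ → ℕ → Bool
nearB n s i j = stepB n s i j ∨ stepB n s j i

DPadj : (n k : ℕ) → Vertex n → Vertex n → Bool
DPadj n k (U , i) (U , j) = nearB n 1 (toℕ i) (toℕ j)
DPadj n k (X , i) (X , j) = nearB n 1 (toℕ i) (toℕ j)
DPadj n k (W , i) (Y , j) = nearB n k (toℕ i) (toℕ j)
DPadj n k (Y , i) (W , j) = nearB n k (toℕ i) (toℕ j)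
DPadj n k (U , i) (W , j) = ⌊ i ≟F j ⌋
DPadj n k (W , i) (U , j) = ⌊ i ≟F j ⌋
DPadj n k (X , i) (Y , j) = ⌊ i ≟F j ⌋
DPadj n k (Y , i) (X , j) = ⌊ i ≟F j ⌋
DPadj n k _ _ = false

allB : ∀ {A : Set} → (A → Bool) → List A → Bool
allB p [] = true
allB p (x ∷ xs) = p x ∧ allB p xs

distinctB : ∀ {n} → List (Vertex n) → Bool
distinctB [] = true
distinctB (v ∷ vs) = allB (λ w → not (eqV v w)) vs ∧ distinctB vs

closedWalkB : ∀ {n} → (Vertex n → Vertex n → Bool) → Vertex n → List (Vertex n) → Bool
closedWalkB adj first [] = true
closedWalkB adj first (v ∷ []) = adj v first
closedWalkB adj first (v ∷ w ∷ vs) = adj v w ∧ closedWalkB adj first (w ∷ vs)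

isCycleB : (n k : ℕ) {m : ℕ} → Vec (Vertex n) m → Bool
isCycleB n k []ᵥ = false
isCycleB n k (v ∷ᵥ vs) = distinctB (v ∷ toList vs) ∧ closedWalkB (DPadj n k) v (v ∷ toList vs)

-- 8-cycles of DP(n,k) through the edge ab.  An 8-cycle C containing the
-- edge {a,b} is encoded uniquely by its traversal a, b, v₂, …, v₇ that
-- starts at a and first walks along the edge to b.
EightCyclesThrough : (n k : ℕ) → Vertex n → Vertex n → Set
EightCyclesThrough n k a b =
  Σ (Vec (Vertex n) 6) (λ rest → T (isCycleB n k (a ∷ᵥ b ∷ᵥ rest)))

Is1Cycle8Regular : (n k ℓ : ℕ) → Set
Is1Cycle8Regular n k ℓ =
  (a b : Vertex n) → T (DPadj n k a b) → Fin ℓ ↔ EightCyclesThrough n k a b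

DPIso : (n k n' k' : ℕ) → Set
DPIso n k n' k' =
  Σ (Vertex n ↔ Vertex n') (λ f →
    (a b : Vertex n) → DPadj n' k' (Inverse.to f a) (Inverse.to f b) ≡ DPadj n k a b)

module Submission where

open import Data.Bool using (Bool; true; false; _∧_; _∨_; not; if_then_else_; T)
open import Data.Bool.Properties using (T-∧; T-∨; T-≡; T-irrelevant; ∨-identityʳ; ∧-zeroʳ) renaming (_≟_ to _≟ᵇ_)
open import Data.Fin using (Fin; zero; toℕ; fromℕ<) renaming (_≟_ to _≟ᶠ_)
open import Data.Fin.Permutation using (↔⇒≡)
open import Data.Fin.Properties using (toℕ-fromℕ<; toℕ-injective; toℕ<n; +↔⊎; all?)
open import Data.Integer as ℤ using (ℤ; +_; -[1+_]; _+_; _-_; _*_; -_; ∣_∣; _%ℕ_; _/ℕ_)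
import Data.Integer.Properties as ℤ
open import Data.Integer.DivMod using (n%ℕd<d; a≡a%ℕn+[a/ℕn]*n)
open import Data.Integer.Divisibility.Signed using (_∣_; divides; quotient; ∣⇒∣ᵤ; ∣m∣n⇒∣m+n; ∣m∣n⇒∣m-n; ∣m⇒∣-m; ∣n⇒∣m*n)
open import Data.Integer.Tactic.RingSolver using (solve-∀)
open import Data.List as List using (List; []; _∷_)
open import Data.Nat as ℕ using (ℕ; zero; suc; NonZero; _<_; _≤_; _≟_; _≤?_; _<?_; z≤n; s≤s)
open import Data.Nat.Divisibility using (>⇒∤) renaming (_∣_ to _∣ℕ_)
open import Data.Nat.DivMod using (m<n⇒m%n≡m)
import Data.Nat.Properties as ℕ
open import Data.Nat.Properties using (anyUpTo?; allUpTo?)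
open import Data.Product using (Σ; ∃; _×_; _,_; proj₁; proj₂)
open import Data.Sum using (_⊎_; inj₁; inj₂; fromInj₁)
open import Data.Sum.Function.Propositional using (_⊎-↔_)
open import Data.Unit using (⊤; tt)
open import Data.Vec as Vec using (Vec; toList) renaming ([] to []ᵥ; _∷_ to _∷ᵥ_)
open import Data.Vec.Properties using (toList-map)
open import Function.Bundles using (_↔_; _⇔_; mk↔ₛ′; mk⇔; Equivalence)
open import Function.Construct.Composition using (_⇔-∘_)
open import Function.Construct.Symmetry using (⇔-sym)
open import Function.Properties.Inverse using (↔-refl; ↔-sym; ↔-trans)
open import Relation.Nullary using (Dec; yes; no; ¬_; ¬?; contradiction; _×-dec_; _⊎-dec_; _→-dec_)
open import Relation.Nullary.Decidable using (⌊_⌋; map′; toWitness; fromWitness; T?)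
open import Relation.Unary using (Decidable)
open import Relation.Binary.PropositionalEquality
open import Defs

-- Lift DP(n,k) to the cubic graph on Kind × ℤ × ℤ in which ⟨ c , a , b ⟩ lies over
-- c_{a+bk}: outer edges change a by ±1, inner edges change b by ±1, spokes keep (a,b).
-- An 8-cycle through a given edge is a non-backtracking closed walk, so it is coded by
-- the six binary turns it takes, and whether a code closes up only depends on which
-- displacements (a,b) with |a| + |b| ≤ 8 satisfy n ∣ a + bk.  Cycle regularity forces
-- an outer edge, a spoke and an inner edge to lie on equally many 8-cycles.  For
-- n ≤ 64 a computation shows this only happens for (n,k) ∈ {(5,2), (10,2), (10,3)}.
-- For n > 64 two short solutions (a₀,b₀) and (a,b) have the multiple b₀a − ba₀ of n
-- of size at most 64, so they are parallel; hence the solutions in the ball are cut out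
-- by one short solution with 1 ≤ b₀ ≤ 8 and a congruence modulo b₀, and the finitely
-- many patterns that arise are all refuted by computation.  Finally DP(10,3) ≅ DP(10,2).

T⇔T⇒≡ : ∀ {b c : Bool} → (T b → T c) → (T c → T b) → b ≡ c
T⇔T⇒≡ {false} {false} _ _ = refl
T⇔T⇒≡ {false} {true}  _ g = contradiction (g _) λ ()
T⇔T⇒≡ {true}  {false} f _ = contradiction (f _) λ ()
T⇔T⇒≡ {true}  {true}  _ _ = refl

∣-resp-≡ : ∀ {k x y} → x ≡ y → k ∣ x → k ∣ y
∣-resp-≡ refl k∣x = k∣x

2*k<n⇒k<n : ∀ {k n} → 2 ℕ.* k < n → k < n
2*k<n⇒k<n {k} = ℕ.≤-<-trans (ℕ.m≤m+n k (k ℕ.+ 0))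

module _ {P : ℤ → Set} (P? : Decidable P) where

  anyInBall? : ∀ m → Dec (∃ λ a → ∣ a ∣ ≤ m × P a)
  anyInBall? m = map′ to from (anyUpTo? (λ j → P? (+ j)) (suc m) ⊎-dec anyUpTo? (λ j → P? -[1+ j ]) m)
    where
    to : (∃ λ j → j < suc m × P (+ j)) ⊎ (∃ λ j → j < m × P -[1+ j ]) → ∃ λ a → ∣ a ∣ ≤ m × P a
    to (inj₁ (j , s≤s j≤m , Pj)) = + j , j≤m , Pj
    to (inj₂ (j , j<m , Pj))     = -[1+ j ] , j<m , Pj
    from : (∃ λ a → ∣ a ∣ ≤ m × P a) → (∃ λ j → j < suc m × P (+ j)) ⊎ (∃ λ j → j < m × P -[1+ j ])
    from (+ j , j≤m , Pj)      = inj₁ (j , s≤s j≤m , Pj)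
    from (-[1+ j ] , j<m , Pj) = inj₂ (j , j<m , Pj)

  allInBall? : ∀ m → Dec (∀ a → ∣ a ∣ ≤ m → P a)
  allInBall? m = map′ to from (allUpTo? (λ j → P? (+ j)) (suc m) ×-dec allUpTo? (λ j → P? -[1+ j ]) m)
    where
    to : (∀ {j} → j < suc m → P (+ j)) × (∀ {j} → j < m → P -[1+ j ]) → ∀ a → ∣ a ∣ ≤ m → P a
    to (P₊ , P₋) (+ j)      j≤m = P₊ (s≤s j≤m)
    to (P₊ , P₋) -[1+ j ]   j<m = P₋ j<m
    from : (∀ a → ∣ a ∣ ≤ m → P a) → (∀ {j} → j < suc m → P (+ j)) × (∀ {j} → j < m → P -[1+ j ])
    from P∀ = (λ { (s≤s j≤m) → P∀ (+ _) j≤m }) , λ j<m → P∀ -[1+ _ ] j<m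

allVertices? : ∀ {n} {P : Vertex n → Set} → Decidable P → Dec (∀ v → P v)
allVertices? {P = P} P? = map′ to from
  (all? (λ i → P? (U , i)) ×-dec all? (λ i → P? (W , i)) ×-dec all? (λ i → P? (X , i)) ×-dec all? (λ i → P? (Y , i)))
  where
  AllOf : Kind → Set
  AllOf c = ∀ i → P (c , i)
  to : AllOf U × AllOf W × AllOf X × AllOf Y → ∀ v → P v
  to (PU , PW , PX , PY) (U , i) = PU i
  to (PU , PW , PX , PY) (W , i) = PW i
  to (PU , PW , PX , PY) (X , i) = PX i
  to (PU , PW , PX , PY) (Y , i) = PY i
  from : (∀ v → P v) → AllOf U × AllOf W × AllOf X × AllOf Y
  from P∀ = (λ i → P∀ (U , i)) , (λ i → P∀ (W , i)) , (λ i → P∀ (X , i)) , (λ i → P∀ (Y , i))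

module Modular (n : ℕ) .{{_ : NonZero n}} where

  divisibleᵇ : ℤ → Bool
  divisibleᵇ x = (x %ℕ n) ℕ.≡ᵇ 0

  residue : ℤ → Fin n
  residue x = fromℕ< (n%ℕd<d x n)

  multiple<n⇒≡0 : ∀ {c} → ∣ c ∣ < n → + n ∣ c → c ≡ + 0
  multiple<n⇒≡0 {c} ∣c∣<n n∣c with ∣ c ∣ in eq
  ... | zero  = ℤ.∣i∣≡0⇒i≡0 eq
  ... | suc _ = contradiction (subst (n ∣ℕ_) eq (∣⇒∣ᵤ n∣c)) (>⇒∤ ∣c∣<n)

  residues-unique : ∀ {r s} → r < n → s < n → + n ∣ + r - + s → r ≡ s
  residues-unique {r} {s} r<n s<n n∣r-s = ℤ.+-injective (ℤ.i-j≡0⇒i≡j _ _ (multiple<n⇒≡0 ∣r-s∣<n n∣r-s))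
    where
    ∣r-s∣<n : ∣ + r - + s ∣ < n
    ∣r-s∣<n = subst (λ z → ∣ z ∣ < n) (sym (ℤ.m-n≡m⊖n r s)) (ℕ.≤-<-trans (ℤ.∣m⊝n∣≤m⊔n r s) (ℕ.⊔-lub r<n s<n))

  ∣-%ℕ : ∀ x → + n ∣ x - + (x %ℕ n)
  ∣-%ℕ x = divides (x /ℕ n) (begin
    x - + (x %ℕ n)                       ≡⟨ cong (_- + (x %ℕ n)) (a≡a%ℕn+[a/ℕn]*n x n) ⟩
    + (x %ℕ n) + x /ℕ n * + n - + (x %ℕ n) ≡⟨ cancel (+ (x %ℕ n)) (x /ℕ n * + n) ⟩
    x /ℕ n * + n                         ∎)
    where
    open ≡-Reasoning
    cancel : ∀ r m → r + m - r ≡ m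
    cancel = solve-∀

  %ℕ-cong : ∀ x y → + n ∣ x - y → x %ℕ n ≡ y %ℕ n
  %ℕ-cong x y n∣x-y = residues-unique (n%ℕd<d x n) (n%ℕd<d y n)
    (∣-resp-≡ (rearrange x y (+ (x %ℕ n)) (+ (y %ℕ n)))
      (∣m∣n⇒∣m-n (∣m∣n⇒∣m+n n∣x-y (∣-%ℕ y)) (∣-%ℕ x)))
    where
    rearrange : ∀ x y r s → (x - y) + (y - s) - (x - r) ≡ r - s
    rearrange = solve-∀

  %ℕ-cong⁻¹ : ∀ x y → x %ℕ n ≡ y %ℕ n → + n ∣ x - y
  %ℕ-cong⁻¹ x y eq = ∣-resp-≡ (rearrange x y (+ (x %ℕ n)))
    (∣m∣n⇒∣m-n (∣-%ℕ x) (subst (λ r → + n ∣ y - + r) (sym eq) (∣-%ℕ y)))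
    where
    rearrange : ∀ x y r → (x - r) - (y - r) ≡ x - y
    rearrange = solve-∀

  T-divisibleᵇ : ∀ x → T (divisibleᵇ x) ⇔ + n ∣ x
  T-divisibleᵇ x = mk⇔
    (λ t → ∣-resp-≡ (ℤ.+-identityʳ x) (subst (λ r → + n ∣ x - + r) (ℕ.≡ᵇ⇒≡ _ 0 t) (∣-%ℕ x)))
    (λ n∣x → ℕ.≡⇒≡ᵇ _ 0 (residues-unique (n%ℕd<d x n) 0<n
      (∣-resp-≡ (rearrange x (+ (x %ℕ n))) (∣m∣n⇒∣m-n n∣x (∣-%ℕ x)))))
    where
    0<n : 0 < n
    0<n = ℕ.n≢0⇒n>0 (ℕ.≢-nonZero⁻¹ n)
    rearrange : ∀ x r → x - (x - r) ≡ r - + 0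
    rearrange = solve-∀

  divisibleᵇ-neg : ∀ x → divisibleᵇ (- x) ≡ divisibleᵇ x
  divisibleᵇ-neg x = T⇔T⇒≡
    (λ t → Equivalence.from (T-divisibleᵇ x)
      (∣-resp-≡ (ℤ.neg-involutive x) (∣m⇒∣-m (Equivalence.to (T-divisibleᵇ (- x)) t))))
    (λ t → Equivalence.from (T-divisibleᵇ (- x)) (∣m⇒∣-m (Equivalence.to (T-divisibleᵇ x) t)))

  residue-≟ : ∀ x y → ⌊ residue x ≟ᶠ residue y ⌋ ≡ divisibleᵇ (x - y)
  residue-≟ x y = T⇔T⇒≡
    (λ t → Equivalence.from (T-divisibleᵇ (x - y)) (%ℕ-cong⁻¹ x y (residue-%ℕ (toWitness t))))
    (λ t → fromWitness (toℕ-injective (trans (toℕ-fromℕ< _)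
      (trans (%ℕ-cong x y (Equivalence.to (T-divisibleᵇ (x - y)) t)) (sym (toℕ-fromℕ< _))))))
    where
    residue-%ℕ : residue x ≡ residue y → x %ℕ n ≡ y %ℕ n
    residue-%ℕ eq = trans (sym (toℕ-fromℕ< _)) (trans (cong toℕ eq) (toℕ-fromℕ< _))

  ∣-toℕ-residue : ∀ x → + n ∣ x - + toℕ (residue x)
  ∣-toℕ-residue x = subst (λ r → + n ∣ x - + r) (sym (toℕ-fromℕ< _)) (∣-%ℕ x)

  private
    ≡ᵇ-or-≡ᵇ+n⇔∣ : ∀ A B → A < n ℕ.+ n → B < n → T ((A ℕ.≡ᵇ B) ∨ (A ℕ.≡ᵇ B ℕ.+ n)) ⇔ + n ∣ + A - + B
    ≡ᵇ-or-≡ᵇ+n⇔∣ A B A<2n B<n = mk⇔ to from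
      where
      n∣n : + n ∣ + n
      n∣n = divides (+ 1) (sym (ℤ.*-identityˡ (+ n)))
      shift : ∀ A′ → + (A′ ℕ.+ n) - + B - + n ≡ + A′ - + B
      shift A′ = trans (cong (λ a → a - + B - + n) (ℤ.pos-+ A′ n)) (rearrange (+ A′) (+ B) (+ n))
        where
        rearrange : ∀ a b m → (a + m) - b - m ≡ a - b
        rearrange = solve-∀
      to : T ((A ℕ.≡ᵇ B) ∨ (A ℕ.≡ᵇ B ℕ.+ n)) → + n ∣ + A - + B
      to t with Equivalence.to T-∨ t
      ... | inj₁ A≡B   rewrite ℕ.≡ᵇ⇒≡ A B A≡B = divides (+ 0) (ℤ.+-inverseʳ (+ B))
      ... | inj₂ A≡B+n rewrite ℕ.≡ᵇ⇒≡ A (B ℕ.+ n) A≡B+n =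
        divides (+ 1) (trans (cong (_- + B) (ℤ.pos-+ B n)) (cancel (+ B) (+ n)))
        where
        cancel : ∀ b m → (b + m) - b ≡ + 1 * m
        cancel = solve-∀
      from : + n ∣ + A - + B → T ((A ℕ.≡ᵇ B) ∨ (A ℕ.≡ᵇ B ℕ.+ n))
      from n∣A-B with A ℕ.<? n
      ... | yes A<n = Equivalence.from T-∨ (inj₁ (ℕ.≡⇒≡ᵇ A B (residues-unique A<n B<n n∣A-B)))
      ... | no  A≮n = Equivalence.from T-∨ (inj₂ (ℕ.≡⇒≡ᵇ A (B ℕ.+ n) A≡B+n))
        where
        n≤A : n ≤ A
        n≤A = ℕ.≮⇒≥ A≮n
        A∸n<n : A ℕ.∸ n < n
        A∸n<n = subst (A ℕ.∸ n <_) (ℕ.m+n∸n≡m n n) (ℕ.∸-monoˡ-< A<2n n≤A)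
        A≡A∸n+n : A ≡ A ℕ.∸ n ℕ.+ n
        A≡A∸n+n = sym (ℕ.m∸n+n≡m n≤A)
        A≡B+n : A ≡ B ℕ.+ n
        A≡B+n = trans A≡A∸n+n (cong (ℕ._+ n) (residues-unique A∸n<n B<n (∣-resp-≡ (shift (A ℕ.∸ n))
          (∣m∣n⇒∣m-n (subst (λ a → + n ∣ + a - + B) A≡A∸n+n n∣A-B) n∣n))))

  ∣⇔∣ : ∀ {x y} → + n ∣ x - y → (+ n ∣ x) ⇔ (+ n ∣ y)
  ∣⇔∣ {x} {y} n∣x-y = mk⇔
    (λ n∣x → ∣-resp-≡ (cancel x y) (∣m∣n⇒∣m-n n∣x n∣x-y))
    (λ n∣y → ∣-resp-≡ (cancel′ x y) (∣m∣n⇒∣m+n n∣x-y n∣y))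
    where
    cancel : ∀ x y → x - (x - y) ≡ y
    cancel = solve-∀
    cancel′ : ∀ x y → (x - y) + y ≡ x
    cancel′ = solve-∀

  stepB-residue : ∀ {s} → s < n → ∀ x y →
    stepB n s (toℕ (residue x)) (toℕ (residue y)) ≡ divisibleᵇ (x + + s - y)
  stepB-residue {s} s<n x y = T⇔T⇒≡ (Equivalence.to stepB⇔) (Equivalence.from stepB⇔)
    where
    i = toℕ (residue x)
    j = toℕ (residue y)
    shift : + n ∣ + (i ℕ.+ s) - + j - (x + + s - y)
    shift = ∣-resp-≡ (trans (rearrange x y (+ i) (+ j) (+ s)) (cong (λ z → z - + j - (x + + s - y)) (sym (ℤ.pos-+ i s))))
      (∣m∣n⇒∣m-n (∣-toℕ-residue y) (∣-toℕ-residue x))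
      where
      rearrange : ∀ x y i j s → (y - j) - (x - i) ≡ i + s - j - (x + s - y)
      rearrange = solve-∀
    stepB⇔ : T (stepB n s i j) ⇔ T (divisibleᵇ (x + + s - y))
    stepB⇔ = ⇔-sym (T-divisibleᵇ (x + + s - y)) ⇔-∘ (∣⇔∣ shift ⇔-∘
      ≡ᵇ-or-≡ᵇ+n⇔∣ (i ℕ.+ s) j (ℕ.+-mono-< (toℕ<n (residue x)) s<n) (toℕ<n (residue y)))

  nearB-residue : ∀ {s} → s < n → ∀ x y →
    nearB n s (toℕ (residue x)) (toℕ (residue y)) ≡ divisibleᵇ (x + + s - y) ∨ divisibleᵇ (x - + s - y)
  nearB-residue {s} s<n x y = cong₂ _∨_ (stepB-residue s<n x y) (begin
    stepB n s (toℕ (residue y)) (toℕ (residue x)) ≡⟨ stepB-residue s<n y x ⟩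
    divisibleᵇ (y + + s - x)                       ≡⟨ cong divisibleᵇ (flip x y (+ s)) ⟩
    divisibleᵇ (- (x - + s - y))                   ≡⟨ divisibleᵇ-neg (x - + s - y) ⟩
    divisibleᵇ (x - + s - y)                       ∎)
    where
    open ≡-Reasoning
    flip : ∀ x y s → y + s - x ≡ - (x - s - y)
    flip = solve-∀

  residue-toℕ : ∀ i → residue (+ toℕ i) ≡ i
  residue-toℕ i = toℕ-injective (trans (toℕ-fromℕ< _) (m<n⇒m%n≡m (toℕ<n i)))

  divisibleᵇ-0 : T (divisibleᵇ (+ 0))
  divisibleᵇ-0 = Equivalence.from (T-divisibleᵇ (+ 0)) (divides (+ 0) refl)

  divisibleᵇ-between : ∀ {m} → 0 < m → m < n → divisibleᵇ (+ m) ≡ false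
  divisibleᵇ-between {m} 0<m m<n = T⇔T⇒≡
    (λ t → ℕ.<⇒≢ 0<m (sym (ℤ.+-injective (multiple<n⇒≡0 m<n (Equivalence.to (T-divisibleᵇ (+ m)) t)))))
    λ ()

private
  +1-1 : ∀ a → a + + 1 - + 1 ≡ a
  +1-1 = solve-∀

  -1+1 : ∀ a → a - + 1 + + 1 ≡ a
  -1+1 = solve-∀

data Lifted : Set where
  ⟨_,_,_⟩ : Kind → ℤ → ℤ → Lifted

data Port : Set where
  plus minus spoke : Port

step : Lifted → Port → Lifted
step ⟨ U , a , b ⟩ plus  = ⟨ U , a + + 1 , b ⟩
step ⟨ U , a , b ⟩ minus = ⟨ U , a - + 1 , b ⟩
step ⟨ U , a , b ⟩ spoke = ⟨ W , a , b ⟩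
step ⟨ X , a , b ⟩ plus  = ⟨ X , a + + 1 , b ⟩
step ⟨ X , a , b ⟩ minus = ⟨ X , a - + 1 , b ⟩
step ⟨ X , a , b ⟩ spoke = ⟨ Y , a , b ⟩
step ⟨ W , a , b ⟩ plus  = ⟨ Y , a , b + + 1 ⟩
step ⟨ W , a , b ⟩ minus = ⟨ Y , a , b - + 1 ⟩
step ⟨ W , a , b ⟩ spoke = ⟨ U , a , b ⟩
step ⟨ Y , a , b ⟩ plus  = ⟨ W , a , b + + 1 ⟩
step ⟨ Y , a , b ⟩ minus = ⟨ W , a , b - + 1 ⟩
step ⟨ Y , a , b ⟩ spoke = ⟨ X , a , b ⟩

reverse : Port → Port
reverse plus  = minus
reverse minus = plus
reverse spoke = spoke

step-reverse : ∀ v p → step (step v p) (reverse p) ≡ v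
step-reverse ⟨ U , a , b ⟩ plus  = cong (λ a → ⟨ U , a , b ⟩) (+1-1 a)
step-reverse ⟨ U , a , b ⟩ minus = cong (λ a → ⟨ U , a , b ⟩) (-1+1 a)
step-reverse ⟨ U , a , b ⟩ spoke = refl
step-reverse ⟨ X , a , b ⟩ plus  = cong (λ a → ⟨ X , a , b ⟩) (+1-1 a)
step-reverse ⟨ X , a , b ⟩ minus = cong (λ a → ⟨ X , a , b ⟩) (-1+1 a)
step-reverse ⟨ X , a , b ⟩ spoke = refl
step-reverse ⟨ W , a , b ⟩ plus  = cong (λ b → ⟨ W , a , b ⟩) (+1-1 b)
step-reverse ⟨ W , a , b ⟩ minus = cong (λ b → ⟨ W , a , b ⟩) (-1+1 b)
step-reverse ⟨ W , a , b ⟩ spoke = refl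
step-reverse ⟨ Y , a , b ⟩ plus  = cong (λ b → ⟨ Y , a , b ⟩) (+1-1 b)
step-reverse ⟨ Y , a , b ⟩ minus = cong (λ b → ⟨ Y , a , b ⟩) (-1+1 b)
step-reverse ⟨ Y , a , b ⟩ spoke = refl

turn : Port → Bool → Port
turn plus  false = minus
turn plus  true  = spoke
turn minus false = plus
turn minus true  = spoke
turn spoke false = plus
turn spoke true  = minus

turn-onto : ∀ p q → q ≢ p → ∃ λ β → turn p β ≡ q
turn-onto plus  minus _ = false , refl
turn-onto plus  spoke _ = true  , refl
turn-onto minus plus  _ = false , refl
turn-onto minus spoke _ = true  , refl
turn-onto spoke plus  _ = false , refl
turn-onto spoke minus _ = true  , refl
turn-onto plus  plus  q≢p = contradiction refl q≢p
turn-onto minus minus q≢p = contradiction refl q≢p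
turn-onto spoke spoke q≢p = contradiction refl q≢p

walk : ∀ {m} → Lifted → Port → Vec Bool m → Vec Lifted m
walk v p []ᵥ = []ᵥ
walk v p (β ∷ᵥ βs) = step v q ∷ᵥ walk (step v q) (reverse q) βs
  where q = turn p β

-- K a b decides whether lifted vertices of the same kind whose positions differ by
-- (a,b) are identified; Quotient K is the graph on Lifted modulo that identification.
Kernel : Set
Kernel = ℤ → ℤ → Bool

module Quotient (K : Kernel) where

  same : Lifted → Lifted → Bool
  same ⟨ c , a , b ⟩ ⟨ d , a′ , b′ ⟩ = (c ≟K d) ∧ K (a - a′) (b - b′)

  adjacent : Lifted → Lifted → Bool
  adjacent v w = same (step v plus) w ∨ same (step v minus) w ∨ same (step v spoke) w

  distinct : List Lifted → Bool
  distinct [] = true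
  distinct (v ∷ vs) = allB (λ w → not (same v w)) vs ∧ distinct vs

  closedWalk : Lifted → List Lifted → Bool
  closedWalk first [] = true
  closedWalk first (v ∷ []) = adjacent v first
  closedWalk first (v ∷ w ∷ vs) = adjacent v w ∧ closedWalk first (w ∷ vs)

  isCycle : List Lifted → Bool
  isCycle [] = false
  isCycle (v ∷ vs) = distinct (v ∷ vs) ∧ closedWalk v (v ∷ vs)

  -- Whether the walk v₀ v₁ … turning as βs says at v₁, v₂, … is an 8-cycle; p is the port of v₁ back to v₀.
  closesCycle : Lifted → Lifted → Port → Vec Bool 6 → Bool
  closesCycle v₀ v₁ p βs = isCycle (v₀ ∷ v₁ ∷ toList (walk v₁ p βs))

count : ∀ m → (Vec Bool m → Bool) → ℕ
count zero P = if P []ᵥ then 1 else 0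
count (suc m) P = count m (λ βs → P (false ∷ᵥ βs)) ℕ.+ count m (λ βs → P (true ∷ᵥ βs))

Satisfying : ∀ {m} → (Vec Bool m → Bool) → Set
Satisfying {m} P = Σ (Vec Bool m) (λ βs → T (P βs))

Satisfying↔count : ∀ m (P : Vec Bool m → Bool) → Satisfying P ↔ Fin (count m P)
Satisfying↔count zero P = ↔-trans (mk↔ₛ′ (λ { ([]ᵥ , t) → t }) ([]ᵥ ,_) (λ _ → refl) (λ { ([]ᵥ , _) → refl })) (T↔Fin (P []ᵥ))
  where
  T↔Fin : ∀ b → T b ↔ Fin (if b then 1 else 0)
  T↔Fin true  = mk↔ₛ′ (λ _ → zero) _ (λ { zero → refl }) (λ _ → refl)
  T↔Fin false = mk↔ₛ′ (λ ()) (λ ()) (λ ()) (λ ())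
Satisfying↔count (suc m) P = ↔-trans split (↔-trans (Satisfying↔count m _ ⊎-↔ Satisfying↔count m _) (↔-sym +↔⊎))
  where
  split : Satisfying P ↔ (Satisfying (λ βs → P (false ∷ᵥ βs)) ⊎ Satisfying (λ βs → P (true ∷ᵥ βs)))
  split = mk↔ₛ′ (λ { (false ∷ᵥ βs , t) → inj₁ (βs , t) ; (true ∷ᵥ βs , t) → inj₂ (βs , t) })
                (λ { (inj₁ (βs , t)) → false ∷ᵥ βs , t ; (inj₂ (βs , t)) → true ∷ᵥ βs , t })
                (λ { (inj₁ _) → refl ; (inj₂ _) → refl })
                (λ { (false ∷ᵥ _ , _) → refl ; (true ∷ᵥ _ , _) → refl })

origin : Kind → Lifted
origin c = ⟨ c , + 0 , + 0 ⟩

cycleCount : Kernel → Lifted → Lifted → Port → ℕ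
cycleCount K v₀ v₁ p = count 6 (Quotient.closesCycle K v₀ v₁ p)

outerCount spokeCount innerCount : Kernel → ℕ
outerCount K = cycleCount K (origin U) (step (origin U) plus) minus
spokeCount K = cycleCount K (origin U) (origin W) spoke
innerCount K = cycleCount K (origin W) (step (origin W) plus) minus

Balanced : Kernel → Set
Balanced K = outerCount K ≡ spokeCount K × spokeCount K ≡ innerCount K

balanced? : ∀ K → Dec (Balanced K)
balanced? K = (outerCount K ≟ spokeCount K) ×-dec (spokeCount K ≟ innerCount K)

count-cong : ∀ m {P Q : Vec Bool m → Bool} → (∀ βs → P βs ≡ Q βs) → count m P ≡ count m Q
count-cong zero    P≗Q = cong (λ b → if b then 1 else 0) (P≗Q []ᵥ)
count-cong (suc m) P≗Q = cong₂ ℕ._+_ (count-cong m (λ βs → P≗Q (false ∷ᵥ βs))) (count-cong m (λ βs → P≗Q (true ∷ᵥ βs)))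

module _ {K K′ : Kernel} (K≗K′ : ∀ a b → K a b ≡ K′ a b) where
  private
    module Q  = Quotient K
    module Q′ = Quotient K′

  same-cong : ∀ u v → Q.same u v ≡ Q′.same u v
  same-cong ⟨ c , a , b ⟩ ⟨ d , a′ , b′ ⟩ = cong ((c ≟K d) ∧_) (K≗K′ (a - a′) (b - b′))

  adjacent-cong : ∀ u v → Q.adjacent u v ≡ Q′.adjacent u v
  adjacent-cong u v = cong₂ _∨_ (same-cong (step u plus) v) (cong₂ _∨_ (same-cong (step u minus) v) (same-cong (step u spoke) v))

  distinct-cong : ∀ vs → Q.distinct vs ≡ Q′.distinct vs
  distinct-cong [] = refl
  distinct-cong (v ∷ vs) = cong₂ _∧_ (all-cong vs) (distinct-cong vs)
    where
    all-cong : ∀ ws → allB (λ w → not (Q.same v w)) ws ≡ allB (λ w → not (Q′.same v w)) ws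
    all-cong [] = refl
    all-cong (w ∷ ws) = cong₂ _∧_ (cong not (same-cong v w)) (all-cong ws)

  closedWalk-cong : ∀ f vs → Q.closedWalk f vs ≡ Q′.closedWalk f vs
  closedWalk-cong f [] = refl
  closedWalk-cong f (v ∷ []) = adjacent-cong v f
  closedWalk-cong f (v ∷ w ∷ vs) = cong₂ _∧_ (adjacent-cong v w) (closedWalk-cong f (w ∷ vs))

  cycleCount-cong : ∀ v₀ v₁ p → cycleCount K v₀ v₁ p ≡ cycleCount K′ v₀ v₁ p
  cycleCount-cong v₀ v₁ p = count-cong 6 λ βs → let vs = v₀ ∷ v₁ ∷ toList (walk v₁ p βs) in
    cong₂ _∧_ (distinct-cong vs) (closedWalk-cong v₀ vs)

  Balanced-cong : Balanced K → Balanced K′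
  Balanced-cong (outer≡spoke , spoke≡inner) =
      trans (sym outer≡) (trans outer≡spoke spoke≡) , trans (sym spoke≡) (trans spoke≡inner inner≡)
    where
    outer≡ = cycleCount-cong (origin U) (step (origin U) plus) minus
    spoke≡ = cycleCount-cong (origin U) (origin W) spoke
    inner≡ = cycleCount-cong (origin W) (step (origin W) plus) minus

ball : Kernel → Kernel
ball K a b = if ∣ a ∣ ℕ.+ ∣ b ∣ ℕ.≤ᵇ 8 then K a b else false

-- Any two vertices compared while counting lie at most 8 steps apart, so Balanced K and
-- Balanced (ball K) have the same normal form.
Balanced-local : ∀ {K K′} → (∀ a b → ∣ a ∣ ℕ.+ ∣ b ∣ ℕ.≤ 8 → K a b ≡ K′ a b) → Balanced K → Balanced K′
Balanced-local {K} {K′} agree = Balanced-cong {ball K} {ball K′} ball-agree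
  where
  ball-agree : ∀ a b → ball K a b ≡ ball K′ a b
  ball-agree a b with ∣ a ∣ ℕ.+ ∣ b ∣ ℕ.≤ᵇ 8 in le
  ... | true  = agree a b (ℕ.≤ᵇ⇒≤ _ _ (subst T (sym le) tt))
  ... | false = refl

kernel : (n : ℕ) .{{_ : NonZero n}} → ℕ → Kernel
kernel n k a b = Modular.divisibleᵇ n (a + b * + k)

module Projection (n k : ℕ) .{{_ : NonZero n}} (3≤n : 3 ≤ n) (1≤k : 1 ≤ k) (2k<n : 2 ℕ.* k < n) where
  open Modular n
  open Quotient (kernel n k)

  project : Lifted → Vertex n
  project ⟨ c , a , b ⟩ = c , residue (a + b * + k)

  private
    1<n : 1 < n
    1<n = ℕ.<⇒≤ 3≤n

    difference : ∀ a b a′ b′ → (a + b * + k) - (a′ + b′ * + k) ≡ (a - a′) + (b - b′) * + k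
    difference a b a′ b′ = ring a b a′ b′ (+ k)
      where
      ring : ∀ a b a′ b′ k → (a + b * k) - (a′ + b′ * k) ≡ (a - a′) + (b - b′) * k
      ring = solve-∀

  project-same : ∀ u v → eqV (project u) (project v) ≡ same u v
  project-same ⟨ c , a , b ⟩ ⟨ d , a′ , b′ ⟩ =
    cong ((c ≟K d) ∧_) (trans (residue-≟ (a + b * + k) (a′ + b′ * + k)) (cong divisibleᵇ (difference a b a′ b′)))

  private
    outer-near : ∀ a b a′ b′ → nearB n 1 (toℕ (residue (a + b * + k))) (toℕ (residue (a′ + b′ * + k)))
      ≡ kernel n k (a + + 1 - a′) (b - b′) ∨ (kernel n k (a - + 1 - a′) (b - b′) ∨ false)
    outer-near a b a′ b′ = trans (nearB-residue 1<n (a + b * + k) (a′ + b′ * + k)) (cong₂ _∨_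
      (cong divisibleᵇ (forward a b a′ b′ (+ k)))
      (trans (cong divisibleᵇ (backward a b a′ b′ (+ k))) (sym (∨-identityʳ _))))
      where
      forward : ∀ a b a′ b′ k → (a + b * k) + + 1 - (a′ + b′ * k) ≡ (a + + 1 - a′) + (b - b′) * k
      forward = solve-∀
      backward : ∀ a b a′ b′ k → (a + b * k) - + 1 - (a′ + b′ * k) ≡ (a - + 1 - a′) + (b - b′) * k
      backward = solve-∀

    inner-near : ∀ a b a′ b′ → nearB n k (toℕ (residue (a + b * + k))) (toℕ (residue (a′ + b′ * + k)))
      ≡ kernel n k (a - a′) (b + + 1 - b′) ∨ (kernel n k (a - a′) (b - + 1 - b′) ∨ false)
    inner-near a b a′ b′ = trans (nearB-residue (2*k<n⇒k<n 2k<n) (a + b * + k) (a′ + b′ * + k)) (cong₂ _∨_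
      (cong divisibleᵇ (forward a b a′ b′ (+ k)))
      (trans (cong divisibleᵇ (backward a b a′ b′ (+ k))) (sym (∨-identityʳ _))))
      where
      forward : ∀ a b a′ b′ k → (a + b * k) + k - (a′ + b′ * k) ≡ (a - a′) + (b + + 1 - b′) * k
      forward = solve-∀
      backward : ∀ a b a′ b′ k → (a + b * k) - k - (a′ + b′ * k) ≡ (a - a′) + (b - + 1 - b′) * k
      backward = solve-∀

    spoke-same : ∀ a b a′ b′ → ⌊ residue (a + b * + k) ≟ᶠ residue (a′ + b′ * + k) ⌋ ≡ kernel n k (a - a′) (b - b′)
    spoke-same a b a′ b′ = trans (residue-≟ (a + b * + k) (a′ + b′ * + k)) (cong divisibleᵇ (difference a b a′ b′))

  project-adjacent : ∀ u v → DPadj n k (project u) (project v) ≡ adjacent u v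
  project-adjacent ⟨ U , a , b ⟩ ⟨ U , a′ , b′ ⟩ = outer-near a b a′ b′
  project-adjacent ⟨ X , a , b ⟩ ⟨ X , a′ , b′ ⟩ = outer-near a b a′ b′
  project-adjacent ⟨ W , a , b ⟩ ⟨ Y , a′ , b′ ⟩ = inner-near a b a′ b′
  project-adjacent ⟨ Y , a , b ⟩ ⟨ W , a′ , b′ ⟩ = inner-near a b a′ b′
  project-adjacent ⟨ U , a , b ⟩ ⟨ W , a′ , b′ ⟩ = spoke-same a b a′ b′
  project-adjacent ⟨ W , a , b ⟩ ⟨ U , a′ , b′ ⟩ = spoke-same a b a′ b′
  project-adjacent ⟨ X , a , b ⟩ ⟨ Y , a′ , b′ ⟩ = spoke-same a b a′ b′
  project-adjacent ⟨ Y , a , b ⟩ ⟨ X , a′ , b′ ⟩ = spoke-same a b a′ b′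
  project-adjacent ⟨ U , _ , _ ⟩ ⟨ X , _ , _ ⟩ = refl
  project-adjacent ⟨ U , _ , _ ⟩ ⟨ Y , _ , _ ⟩ = refl
  project-adjacent ⟨ W , _ , _ ⟩ ⟨ W , _ , _ ⟩ = refl
  project-adjacent ⟨ W , _ , _ ⟩ ⟨ X , _ , _ ⟩ = refl
  project-adjacent ⟨ X , _ , _ ⟩ ⟨ U , _ , _ ⟩ = refl
  project-adjacent ⟨ X , _ , _ ⟩ ⟨ W , _ , _ ⟩ = refl
  project-adjacent ⟨ Y , _ , _ ⟩ ⟨ U , _ , _ ⟩ = refl
  project-adjacent ⟨ Y , _ , _ ⟩ ⟨ Y , _ , _ ⟩ = refl

  private
    ≟K⇒≡ : ∀ c d → T (c ≟K d) → c ≡ d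
    ≟K⇒≡ U U _ = refl
    ≟K⇒≡ W W _ = refl
    ≟K⇒≡ X X _ = refl
    ≟K⇒≡ Y Y _ = refl

    ≟K-refl : ∀ c → T (c ≟K c)
    ≟K-refl U = tt
    ≟K-refl W = tt
    ≟K-refl X = tt
    ≟K-refl Y = tt

  eqV⇒≡ : ∀ (x y : Vertex n) → T (eqV x y) → x ≡ y
  eqV⇒≡ (c , i) (d , j) t = let c≟d , i≟j = Equivalence.to T-∧ t in
    cong₂ _,_ (≟K⇒≡ c d c≟d) (toWitness i≟j)

  eqV-refl : ∀ (x : Vertex n) → T (eqV x x)
  eqV-refl (c , i) = Equivalence.from T-∧ (≟K-refl c , fromWitness refl)

  section : Vertex n → Lifted
  section (c , i) = ⟨ c , + toℕ i , + 0 ⟩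

  project-section : ∀ x → project (section x) ≡ x
  project-section (c , i) = cong (c ,_) (trans (cong residue (ℤ.+-identityʳ (+ toℕ i))) (residue-toℕ i))

  adjacent⇒step : ∀ v x → T (DPadj n k (project v) x) → ∃ λ p → project (step v p) ≡ x
  adjacent⇒step v x t = port (Equivalence.to T-∨ adj)
    where
    adj : T (adjacent v (section x))
    adj = subst T (project-adjacent v (section x))
      (subst (λ y → T (DPadj n k (project v) y)) (sym (project-section x)) t)
    reached : ∀ p → T (same (step v p) (section x)) → project (step v p) ≡ x
    reached p s = trans (eqV⇒≡ _ _ (subst T (sym (project-same (step v p) (section x))) s)) (project-section x)
    port : T (same (step v plus) (section x)) ⊎ T (same (step v minus) (section x) ∨ same (step v spoke) (section x))
         → ∃ λ p → project (step v p) ≡ x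
    port (inj₁ s) = plus , reached plus s
    port (inj₂ s) with Equivalence.to T-∨ s
    ... | inj₁ s′ = minus , reached minus s′
    ... | inj₂ s′ = spoke , reached spoke s′

  onward-distinct : ∀ v p → eqV (project (step v (turn p false))) (project (step v (turn p true))) ≡ false
  onward-distinct v p = trans (project-same (step v (turn p false)) (step v (turn p true))) (distinctᴷ v p)
    where
    outer : ∀ a b → kernel n k (a + + 1 - (a - + 1)) (b - b) ≡ false
    outer a b = trans (cong divisibleᵇ (two a b (+ k))) (divisibleᵇ-between (s≤s z≤n) 3≤n)
      where
      two : ∀ a b k → (a + + 1 - (a - + 1)) + (b - b) * k ≡ + 2
      two = solve-∀
    inner : ∀ a b → kernel n k (a - a) (b + + 1 - (b - + 1)) ≡ false
    inner a b = trans (cong divisibleᵇ (trans (two a b (+ k)) (sym (ℤ.pos-* 2 k))))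
      (divisibleᵇ-between (ℕ.<-≤-trans 1≤k (ℕ.m≤m+n k (k ℕ.+ 0))) 2k<n)
      where
      two : ∀ a b k → (a - a) + (b + + 1 - (b - + 1)) * k ≡ + 2 * k
      two = solve-∀
    distinctᴷ : ∀ v p → same (step v (turn p false)) (step v (turn p true)) ≡ false
    distinctᴷ ⟨ U , a , b ⟩ spoke = outer a b
    distinctᴷ ⟨ X , a , b ⟩ spoke = outer a b
    distinctᴷ ⟨ W , a , b ⟩ spoke = inner a b
    distinctᴷ ⟨ Y , a , b ⟩ spoke = inner a b
    distinctᴷ ⟨ U , _ , _ ⟩ plus  = refl
    distinctᴷ ⟨ U , _ , _ ⟩ minus = refl
    distinctᴷ ⟨ X , _ , _ ⟩ plus  = refl
    distinctᴷ ⟨ X , _ , _ ⟩ minus = refl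
    distinctᴷ ⟨ W , _ , _ ⟩ plus  = refl
    distinctᴷ ⟨ W , _ , _ ⟩ minus = refl
    distinctᴷ ⟨ Y , _ , _ ⟩ plus  = refl
    distinctᴷ ⟨ Y , _ , _ ⟩ minus = refl

  turnTowards : Lifted → Port → Vertex n → Bool
  turnTowards v p x = not (eqV (project (step v (turn p false))) x)

  turns : ∀ {m} → Lifted → Port → Vec (Vertex n) m → Vec Bool m
  turns v p []ᵥ = []ᵥ
  turns v p (x ∷ᵥ xs) = β ∷ᵥ turns (step v (turn p β)) (reverse (turn p β)) xs
    where β = turnTowards v p x

  turnTowards-turn : ∀ v p β → turnTowards v p (project (step v (turn p β))) ≡ β
  turnTowards-turn v p false = cong not (Equivalence.to T-≡ (eqV-refl (project (step v (turn p false)))))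
  turnTowards-turn v p true  = cong not (onward-distinct v p)

  turns-walk : ∀ {m} v p (βs : Vec Bool m) → turns v p (Vec.map project (walk v p βs)) ≡ βs
  turns-walk v p []ᵥ = refl
  turns-walk v p (β ∷ᵥ βs) rewrite turnTowards-turn v p β =
    cong (β ∷ᵥ_) (turns-walk (step v (turn p β)) (reverse (turn p β)) βs)

  step-towards : ∀ v p x → T (DPadj n k (project v) x) → x ≢ project (step v p) →
    project (step v (turn p (turnTowards v p x))) ≡ x
  step-towards v p x adj x≢prev with adjacent⇒step v x adj
  ... | q , refl with turn-onto p q (λ { refl → x≢prev refl })
  ... | β , refl rewrite turnTowards-turn v p β = refl

  NonBacktracking : ∀ {m} → Vertex n → Vertex n → Vec (Vertex n) m → Set
  NonBacktracking prev x []ᵥ = ⊤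
  NonBacktracking prev x (y ∷ᵥ ys) = T (DPadj n k x y) × y ≢ prev × NonBacktracking x y ys

  walk-turns : ∀ {m} v p (xs : Vec (Vertex n) m) → NonBacktracking (project (step v p)) (project v) xs →
    Vec.map project (walk v p (turns v p xs)) ≡ xs
  walk-turns v p []ᵥ _ = refl
  walk-turns v p (x ∷ᵥ xs) (adj , x≢prev , nb) = cong₂ _∷ᵥ_ reached (walk-turns (step v q) (reverse q) xs nb′)
    where
    q = turn p (turnTowards v p x)
    reached : project (step v q) ≡ x
    reached = step-towards v p x adj x≢prev
    nb′ : NonBacktracking (project (step (step v q) (reverse q))) (project (step v q)) xs
    nb′ = subst₂ (λ prev y → NonBacktracking prev y xs) (sym (cong project (step-reverse v q))) (sym reached) nb

  cycle⇒nonBacktracking : ∀ {m} prev x f (ys : Vec (Vertex n) m) →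
    T (distinctB (prev ∷ x ∷ toList ys)) → T (closedWalkB (DPadj n k) f (x ∷ toList ys)) →
    NonBacktracking prev x ys
  cycle⇒nonBacktracking prev x f []ᵥ _ _ = tt
  cycle⇒nonBacktracking prev x f (y ∷ᵥ ys) dist closed =
    proj₁ closed-parts , y≢prev , cycle⇒nonBacktracking x y f ys (proj₂ dist-parts) (proj₂ closed-parts)
    where
    dist-parts : T (allB (λ z → not (eqV prev z)) (x ∷ y ∷ toList ys)) × T (distinctB (x ∷ y ∷ toList ys))
    dist-parts = Equivalence.to T-∧ dist
    closed-parts : T (DPadj n k x y) × T (closedWalkB (DPadj n k) f (y ∷ toList ys))
    closed-parts = Equivalence.to T-∧ closed
    y-fresh : T (not (eqV prev y))
    y-fresh = proj₁ (Equivalence.to T-∧ (proj₂ (Equivalence.to (T-∧ {not (eqV prev x)}) (proj₁ dist-parts))))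
    y≢prev : y ≢ prev
    y≢prev refl = subst (λ b → T (not b)) (Equivalence.to T-≡ (eqV-refl y)) y-fresh

  private
    distinctB-project : ∀ vs → distinctB (List.map project vs) ≡ distinct vs
    distinctB-project [] = refl
    distinctB-project (v ∷ vs) = cong₂ _∧_ (fresh vs) (distinctB-project vs)
      where
      fresh : ∀ ws → allB (λ x → not (eqV (project v) x)) (List.map project ws) ≡ allB (λ w → not (same v w)) ws
      fresh [] = refl
      fresh (w ∷ ws) = cong₂ _∧_ (cong not (project-same v w)) (fresh ws)

    closedWalkB-project : ∀ f vs → closedWalkB (DPadj n k) (project f) (List.map project vs) ≡ closedWalk f vs
    closedWalkB-project f [] = refl
    closedWalkB-project f (v ∷ []) = project-adjacent v f
    closedWalkB-project f (v ∷ w ∷ vs) = cong₂ _∧_ (project-adjacent v w) (closedWalkB-project f (w ∷ vs))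

  isCycleB-walk : ∀ v₀ v₁ p βs →
    isCycleB n k (project v₀ ∷ᵥ project v₁ ∷ᵥ Vec.map project (walk v₁ p βs)) ≡ closesCycle v₀ v₁ p βs
  isCycleB-walk v₀ v₁ p βs rewrite toList-map project (walk v₁ p βs) =
    cong₂ _∧_ (distinctB-project vs) (closedWalkB-project v₀ vs)
    where vs = v₀ ∷ v₁ ∷ toList (walk v₁ p βs)

  eightCycles↔ : ∀ v₀ v₁ p → project (step v₁ p) ≡ project v₀ →
    EightCyclesThrough n k (project v₀) (project v₁) ↔ Satisfying (closesCycle v₀ v₁ p)
  eightCycles↔ v₀ v₁ p back = mk↔ₛ′ encode decode encode-decode decode-encode
    where
    cycle-walk : ∀ rest → T (isCycleB n k (project v₀ ∷ᵥ project v₁ ∷ᵥ rest)) →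
      Vec.map project (walk v₁ p (turns v₁ p rest)) ≡ rest
    cycle-walk rest c = walk-turns v₁ p rest (subst (λ prev → NonBacktracking prev (project v₁) rest) (sym back)
      (cycle⇒nonBacktracking (project v₀) (project v₁) (project v₀) rest (proj₁ parts)
        (proj₂ (Equivalence.to (T-∧ {DPadj n k (project v₀) (project v₁)}) (proj₂ parts)))))
      where
      parts : T (distinctB (project v₀ ∷ project v₁ ∷ toList rest))
            × T (closedWalkB (DPadj n k) (project v₀) (project v₀ ∷ project v₁ ∷ toList rest))
      parts = Equivalence.to T-∧ c
    encode : EightCyclesThrough n k (project v₀) (project v₁) → Satisfying (closesCycle v₀ v₁ p)
    encode (rest , c) = turns v₁ p rest , subst T (trans
      (cong (λ r → isCycleB n k (project v₀ ∷ᵥ project v₁ ∷ᵥ r)) (sym (cycle-walk rest c)))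
      (isCycleB-walk v₀ v₁ p (turns v₁ p rest))) c
    decode : Satisfying (closesCycle v₀ v₁ p) → EightCyclesThrough n k (project v₀) (project v₁)
    decode (βs , c) = Vec.map project (walk v₁ p βs) , subst T (sym (isCycleB-walk v₀ v₁ p βs)) c
    Σ-≡ : ∀ {A : Set} {P : A → Bool} {x y} {px : T (P x)} {py : T (P y)} → x ≡ y → (x , px) ≡ (y , py)
    Σ-≡ {px = px} {py} refl = cong (_ ,_) (T-irrelevant px py)
    encode-decode : ∀ c → encode (decode c) ≡ c
    encode-decode (βs , _) = Σ-≡ (turns-walk v₁ p βs)
    decode-encode : ∀ c → decode (encode c) ≡ c
    decode-encode (rest , c) = Σ-≡ (cycle-walk rest c)

  same-refl : ∀ v → T (same v v)
  same-refl ⟨ c , a , b ⟩ = Equivalence.from T-∧ (≟K-refl c , subst (λ z → T (divisibleᵇ z)) (sym (vanish a b (+ k))) divisibleᵇ-0)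
    where
    vanish : ∀ a b k → (a - a) + (b - b) * k ≡ + 0
    vanish = solve-∀

  adjacent-step : ∀ v p → T (adjacent v (step v p))
  adjacent-step v plus  = Equivalence.from T-∨ (inj₁ (same-refl (step v plus)))
  adjacent-step v minus = Equivalence.from (T-∨ {same (step v plus) (step v minus)})
    (inj₂ (Equivalence.from T-∨ (inj₁ (same-refl (step v minus)))))
  adjacent-step v spoke = Equivalence.from (T-∨ {same (step v plus) (step v spoke)})
    (inj₂ (Equivalence.from (T-∨ {same (step v minus) (step v spoke)}) (inj₂ (same-refl (step v spoke)))))

  regular⇒cycleCount : ∀ {ℓ} → Is1Cycle8Regular n k ℓ → ∀ v p → ℓ ≡ cycleCount (kernel n k) v (step v p) (reverse p)
  regular⇒cycleCount regular v p = ↔⇒≡ (↔-trans (regular (project v) (project (step v p)) adj) (↔-trans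
    (eightCycles↔ v (step v p) (reverse p) (cong project (step-reverse v p)))
    (Satisfying↔count 6 _)))
    where
    adj : T (DPadj n k (project v) (project (step v p)))
    adj = subst T (sym (project-adjacent v (step v p))) (adjacent-step v p)

  regular⇒balanced : ∀ {ℓ} → Is1Cycle8Regular n k ℓ → Balanced (kernel n k)
  regular⇒balanced regular = trans (sym (ℓ≡ (origin U) plus)) (ℓ≡ (origin U) spoke)
                           , trans (sym (ℓ≡ (origin U) spoke)) (ℓ≡ (origin W) plus)
    where ℓ≡ = regular⇒cycleCount regular

trivialKernel : Kernel
trivialKernel a b = ⌊ a ℤ.≟ + 0 ⌋ ∧ ⌊ b ℤ.≟ + 0 ⌋

-- If a₀ + b₀k = Qn, a short (a,b) solves n ∣ a + bk iff b₀a = ba₀ and b₀ ∣ bQ;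
-- lineKernel b₀ (Q mod b₀) a₀ tests exactly this.
lineKernel : (b₀ : ℕ) .{{_ : NonZero b₀}} → ℕ → ℤ → Kernel
lineKernel b₀ r a₀ a b = ⌊ + b₀ * a ℤ.≟ b * a₀ ⌋ ∧ Modular.divisibleᵇ b₀ (b * + r)

ShortRelation : (n : ℕ) .{{_ : NonZero n}} → ℕ → Set
ShortRelation n k = ∃ λ m → m < 8 × ∃ λ a₀ → ∣ a₀ ∣ ≤ 8 × T (kernel n k a₀ (+ suc m))

shortRelation? : (n : ℕ) .{{_ : NonZero n}} → ∀ k → Dec (ShortRelation n k)
shortRelation? n k = anyUpTo? (λ m → anyInBall? (λ a₀ → T? (kernel n k a₀ (+ suc m))) 8) 8

module LargeModulus (n k : ℕ) .{{_ : NonZero n}} (64<n : 64 < n) where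
  open Modular n

  private
    ≤8⇒<n : ∀ {m} → m ≤ 8 → m < n
    ≤8⇒<n m≤8 = ℕ.≤-<-trans m≤8 (ℕ.<-trans (s≤s (ℕ.m≤m+n 8 55)) 64<n)

    unrelated : ¬ ShortRelation n k → ∀ a m → ∣ a ∣ ≤ 8 → m < 8 → kernel n k a (+ suc m) ≡ false
    unrelated none a m ∣a∣≤8 m<8 = T⇔T⇒≡ (λ t → none (m , m<8 , a , ∣a∣≤8 , t)) λ ()

  kernel-trivial : ¬ ShortRelation n k → ∀ a b → ∣ a ∣ ℕ.+ ∣ b ∣ ≤ 8 → kernel n k a b ≡ trivialKernel a b
  kernel-trivial none a (+ zero) le = T⇔T⇒≡ to from
    where
    ∣a∣≤8 : ∣ a ∣ ≤ 8
    ∣a∣≤8 = subst (_≤ 8) (ℕ.+-identityʳ ∣ a ∣) le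
    to : T (kernel n k a (+ 0)) → T (trivialKernel a (+ 0))
    to t = Equivalence.from (T-∧ {⌊ a ℤ.≟ + 0 ⌋}) (fromWitness (multiple<n⇒≡0 (≤8⇒<n ∣a∣≤8)
      (∣-resp-≡ (ℤ.+-identityʳ a) (Equivalence.to (T-divisibleᵇ (a + + 0)) t))) , _)
    from : T (trivialKernel a (+ 0)) → T (kernel n k a (+ 0))
    from t with toWitness (proj₁ (Equivalence.to (T-∧ {⌊ a ℤ.≟ + 0 ⌋}) t))
    ... | refl = divisibleᵇ-0
  kernel-trivial none a (+ suc m) le =
    trans (unrelated none a m (ℕ.≤-trans (ℕ.m≤m+n ∣ a ∣ (suc m)) le) (ℕ.≤-trans (ℕ.m≤n+m (suc m) ∣ a ∣) le))
          (sym (∧-zeroʳ _))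
  kernel-trivial none a -[1+ m ] le = begin
    kernel n k a -[1+ m ]                 ≡⟨ cong divisibleᵇ (negate a (+ suc m) (+ k)) ⟩
    divisibleᵇ (- (- a + + suc m * + k))  ≡⟨ divisibleᵇ-neg (- a + + suc m * + k) ⟩
    kernel n k (- a) (+ suc m)            ≡⟨ unrelated none (- a) m ∣-a∣≤8 (ℕ.≤-trans (ℕ.m≤n+m (suc m) ∣ a ∣) le) ⟩
    false                                 ≡⟨ ∧-zeroʳ _ ⟨
    trivialKernel a -[1+ m ]              ∎
    where
    open ≡-Reasoning
    negate : ∀ a s k → a + (- s) * k ≡ - (- a + s * k)
    negate = solve-∀
    ∣-a∣≤8 : ∣ - a ∣ ≤ 8
    ∣-a∣≤8 = subst (_≤ 8) (sym (ℤ.∣-i∣≡∣i∣ a)) (ℕ.≤-trans (ℕ.m≤m+n ∣ a ∣ (suc m)) le)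

  module _ (m : ℕ) (m<8 : m < 8) (a₀ : ℤ) (∣a₀∣≤8 : ∣ a₀ ∣ ≤ 8) (rel : + n ∣ a₀ + + suc m * + k) where
    private
      b₀ = suc m
      Q = quotient rel
      module B = Modular b₀

      Q-rel : a₀ + + b₀ * + k ≡ Q * + n
      Q-rel = _∣_.equality rel

      cross<n : ∀ a b → ∣ a ∣ ℕ.+ ∣ b ∣ ≤ 8 → ∣ + b₀ * a - b * a₀ ∣ < n
      cross<n a b le = ℕ.≤-<-trans (begin
        ∣ + b₀ * a - b * a₀ ∣                ≤⟨ ℤ.∣i-j∣≤∣i∣+∣j∣ (+ b₀ * a) (b * a₀) ⟩
        ∣ + b₀ * a ∣ ℕ.+ ∣ b * a₀ ∣          ≡⟨ cong₂ ℕ._+_ (ℤ.abs-* (+ b₀) a) (ℤ.abs-* b a₀) ⟩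
        b₀ ℕ.* ∣ a ∣ ℕ.+ ∣ b ∣ ℕ.* ∣ a₀ ∣    ≤⟨ ℕ.+-mono-≤ (ℕ.*-monoˡ-≤ ∣ a ∣ m<8) (ℕ.*-monoʳ-≤ ∣ b ∣ ∣a₀∣≤8) ⟩
        8 ℕ.* ∣ a ∣ ℕ.+ ∣ b ∣ ℕ.* 8          ≡⟨ cong (8 ℕ.* ∣ a ∣ ℕ.+_) (ℕ.*-comm ∣ b ∣ 8) ⟩
        8 ℕ.* ∣ a ∣ ℕ.+ 8 ℕ.* ∣ b ∣          ≡⟨ ℕ.*-distribˡ-+ 8 ∣ a ∣ ∣ b ∣ ⟨
        8 ℕ.* (∣ a ∣ ℕ.+ ∣ b ∣)              ≤⟨ ℕ.*-monoʳ-≤ 8 le ⟩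
        64                                   ∎) 64<n
        where open ℕ.≤-Reasoning

      on-line : ∀ a b → ∣ a ∣ ℕ.+ ∣ b ∣ ≤ 8 → + n ∣ a + b * + k → + b₀ * a ≡ b * a₀ × + b₀ ∣ b * Q
      on-line a b le (divides Q′ eq) = ℤ.i-j≡0⇒i≡j _ _ cross≡0 , divides Q′ bQ≡
        where
        cross≡ : + b₀ * a - b * a₀ ≡ (+ b₀ * Q′ - b * Q) * + n
        cross≡ = begin
          + b₀ * a - b * a₀                             ≡⟨ expand (+ b₀) a b a₀ (+ k) ⟩
          + b₀ * (a + b * + k) - b * (a₀ + + b₀ * + k)  ≡⟨ cong₂ (λ x y → + b₀ * x - b * y) eq Q-rel ⟩
          + b₀ * (Q′ * + n) - b * (Q * + n)             ≡⟨ collect (+ b₀) b Q′ Q (+ n) ⟩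
          (+ b₀ * Q′ - b * Q) * + n                     ∎
          where
          open ≡-Reasoning
          expand : ∀ b₀ a b a₀ k → b₀ * a - b * a₀ ≡ b₀ * (a + b * k) - b * (a₀ + b₀ * k)
          expand = solve-∀
          collect : ∀ b₀ b Q′ Q n → b₀ * (Q′ * n) - b * (Q * n) ≡ (b₀ * Q′ - b * Q) * n
          collect = solve-∀
        cross≡0 : + b₀ * a - b * a₀ ≡ + 0
        cross≡0 = multiple<n⇒≡0 (cross<n a b le) (divides (+ b₀ * Q′ - b * Q) cross≡)
        coefficient≡0 : + b₀ * Q′ - b * Q ≡ + 0
        coefficient≡0 with ℤ.i*j≡0⇒i≡0∨j≡0 (+ b₀ * Q′ - b * Q) (trans (sym cross≡) cross≡0)
        ... | inj₁ c≡0 = c≡0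
        ... | inj₂ n≡0 = contradiction (ℤ.+-injective n≡0) (ℕ.≢-nonZero⁻¹ n)
        bQ≡ : b * Q ≡ Q′ * + b₀
        bQ≡ = sym (trans (ℤ.*-comm Q′ (+ b₀)) (ℤ.i-j≡0⇒i≡j _ _ coefficient≡0))

      off-line : ∀ a b → + b₀ * a ≡ b * a₀ → + b₀ ∣ b * Q → + n ∣ a + b * + k
      off-line a b parallel (divides R bQ≡) = divides R (ℤ.*-cancelˡ-≡ (+ b₀) _ _ (begin
        + b₀ * (a + b * + k)          ≡⟨ distrib (+ b₀) a b (+ k) ⟩
        + b₀ * a + b * (+ b₀ * + k)   ≡⟨ cong (_+ b * (+ b₀ * + k)) parallel ⟩
        b * a₀ + b * (+ b₀ * + k)     ≡⟨ ℤ.*-distribˡ-+ b a₀ (+ b₀ * + k) ⟨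
        b * (a₀ + + b₀ * + k)         ≡⟨ cong (b *_) Q-rel ⟩
        b * (Q * + n)                 ≡⟨ ℤ.*-assoc b Q (+ n) ⟨
        b * Q * + n                   ≡⟨ cong (_* + n) bQ≡ ⟩
        R * + b₀ * + n                ≡⟨ rotate R (+ b₀) (+ n) ⟩
        + b₀ * (R * + n)              ∎))
        where
        open ≡-Reasoning
        distrib : ∀ b₀ a b k → b₀ * (a + b * k) ≡ b₀ * a + b * (b₀ * k)
        distrib = solve-∀
        rotate : ∀ R b₀ n → R * b₀ * n ≡ b₀ * (R * n)
        rotate = solve-∀

      ∣bQ⇔∣br : ∀ b → (+ b₀ ∣ b * Q) ⇔ (+ b₀ ∣ b * + (Q %ℕ b₀))
      ∣bQ⇔∣br b = mk⇔
        (λ b₀∣bQ → ∣-resp-≡ (cancel (b * Q) (b * + r)) (∣m∣n⇒∣m-n b₀∣bQ b₀∣bQ-br))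
        (λ b₀∣br → ∣-resp-≡ (cancel′ (b * Q) (b * + r)) (∣m∣n⇒∣m+n b₀∣bQ-br b₀∣br))
        where
        r = Q %ℕ b₀
        distrib : ∀ b Q r → b * (Q - r) ≡ b * Q - b * r
        distrib = solve-∀
        b₀∣bQ-br : + b₀ ∣ b * Q - b * + r
        b₀∣bQ-br = ∣-resp-≡ (distrib b Q (+ r)) (∣n⇒∣m*n b (B.∣-%ℕ Q))
        cancel : ∀ x y → x - (x - y) ≡ y
        cancel = solve-∀
        cancel′ : ∀ x y → (x - y) + y ≡ x
        cancel′ = solve-∀

    kernel-line : ∀ a b → ∣ a ∣ ℕ.+ ∣ b ∣ ≤ 8 → kernel n k a b ≡ lineKernel b₀ (Q %ℕ b₀) a₀ a b
    kernel-line a b le = T⇔T⇒≡ to from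
      where
      to : T (kernel n k a b) → T (lineKernel b₀ (Q %ℕ b₀) a₀ a b)
      to t = Equivalence.from (T-∧ {⌊ + b₀ * a ℤ.≟ b * a₀ ⌋}) (fromWitness (proj₁ line) ,
        Equivalence.from (B.T-divisibleᵇ (b * + (Q %ℕ b₀))) (Equivalence.to (∣bQ⇔∣br b) (proj₂ line)))
        where
        line : + b₀ * a ≡ b * a₀ × + b₀ ∣ b * Q
        line = on-line a b le (Equivalence.to (T-divisibleᵇ (a + b * + k)) t)
      from : T (lineKernel b₀ (Q %ℕ b₀) a₀ a b) → T (kernel n k a b)
      from t = Equivalence.from (T-divisibleᵇ (a + b * + k)) (off-line a b (toWitness (proj₁ parts))
        (Equivalence.from (∣bQ⇔∣br b) (Equivalence.to (B.T-divisibleᵇ (b * + (Q %ℕ b₀))) (proj₂ parts))))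
        where
        parts : T ⌊ + b₀ * a ℤ.≟ b * a₀ ⌋ × T (B.divisibleᵇ (b * + (Q %ℕ b₀)))
        parts = Equivalence.to T-∧ t

trivialKernel-unbalanced : ¬ Balanced trivialKernel
trivialKernel-unbalanced = toWitness {a? = ¬? (balanced? trivialKernel)} _

lineKernels-unbalanced : ∀ {m} → m < 8 → ∀ {r} → r < suc m → ∀ a₀ → ∣ a₀ ∣ ≤ 8 → ¬ Balanced (lineKernel (suc m) r a₀)
lineKernels-unbalanced = toWitness {a? = allUpTo? (λ m → allUpTo? (λ r → allInBall? (λ a₀ → ¬? (balanced? (lineKernel (suc m) r a₀))) 8) (suc m)) 8} _

large-unbalanced : (n k : ℕ) .{{_ : NonZero n}} → 64 < n → ¬ Balanced (kernel n k)
large-unbalanced n k 64<n balanced with shortRelation? n k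
... | no none = trivialKernel-unbalanced (Balanced-local (kernel-trivial none) balanced)
  where open LargeModulus n k 64<n
... | yes (m , m<8 , a₀ , ∣a₀∣≤8 , short) = lineKernels-unbalanced m<8 (n%ℕd<d (quotient rel) (suc m)) a₀ ∣a₀∣≤8
  (Balanced-local (kernel-line m m<8 a₀ ∣a₀∣≤8 rel) balanced)
  where
  open LargeModulus n k 64<n
  rel : + n ∣ a₀ + + suc m * + k
  rel = Equivalence.to (Modular.T-divisibleᵇ n (a₀ + + suc m * + k)) short

rotate₅ : Fin 10 → Fin 10
rotate₅ i = Modular.residue 10 (+ toℕ i + + 5)

rotate₅-involutive : ∀ i → rotate₅ (rotate₅ i) ≡ i
rotate₅-involutive = toWitness {a? = all? (λ i → rotate₅ (rotate₅ i) ≟ᶠ i)} _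

-- x_i ↦ x_{i+5} and y_i ↦ y_{i+5}; in general this maps DP(2m,k) onto DP(2m,m−k).
halfTurn : Vertex 10 → Vertex 10
halfTurn (U , i) = U , i
halfTurn (W , i) = W , i
halfTurn (X , i) = X , rotate₅ i
halfTurn (Y , i) = Y , rotate₅ i

halfTurn-involutive : ∀ v → halfTurn (halfTurn v) ≡ v
halfTurn-involutive (U , i) = refl
halfTurn-involutive (W , i) = refl
halfTurn-involutive (X , i) = cong (X ,_) (rotate₅-involutive i)
halfTurn-involutive (Y , i) = cong (Y ,_) (rotate₅-involutive i)

halfTurn-adjacency : ∀ a b → DPadj 10 2 (halfTurn a) (halfTurn b) ≡ DPadj 10 3 a b
halfTurn-adjacency = toWitness {a? = allVertices? λ a → allVertices? λ b →
  DPadj 10 2 (halfTurn a) (halfTurn b) ≟ᵇ DPadj 10 3 a b} _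

DP10,3≅DP10,2 : DPIso 10 3 10 2
DP10,3≅DP10,2 = mk↔ₛ′ halfTurn halfTurn halfTurn-involutive halfTurn-involutive , halfTurn-adjacency

Exceptional : ℕ → ℕ → Set
Exceptional n k = n ≡ 5 × k ≡ 2 ⊎ n ≡ 10 × k ≡ 2 ⊎ n ≡ 10 × k ≡ 3

exceptional? : ∀ n k → Dec (Exceptional n k)
exceptional? n k = ((n ≟ 5) ×-dec (k ≟ 2)) ⊎-dec ((n ≟ 10) ×-dec (k ≟ 2)) ⊎-dec ((n ≟ 10) ×-dec (k ≟ 3))

exceptional⇒DPIso : ∀ {n k} → Exceptional n k → DPIso n k 5 2 ⊎ DPIso n k 10 2
exceptional⇒DPIso (inj₁ (refl , refl))        = inj₁ (↔-refl , λ _ _ → refl)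
exceptional⇒DPIso (inj₂ (inj₁ (refl , refl))) = inj₂ (↔-refl , λ _ _ → refl)
exceptional⇒DPIso (inj₂ (inj₂ (refl , refl))) = inj₂ DP10,3≅DP10,2

-- Indexed by p = n − 1, so that kernel n k is defined throughout the search.
SmallCase : ℕ → ℕ → Set
SmallCase p k = 1 ≤ k → 2 ℕ.* k < suc p → Exceptional (suc p) k ⊎ ¬ Balanced (kernel (suc p) k)

smallCase? : ∀ p k → Dec (SmallCase p k)
smallCase? p k = (1 ≤? k) →-dec ((2 ℕ.* k <? suc p) →-dec (exceptional? (suc p) k ⊎-dec ¬? (balanced? (kernel (suc p) k))))

small-cases : ∀ {p} → p < 64 → ∀ {k} → k < suc p → SmallCase p k
small-cases = toWitness {a? = allUpTo? (λ p → allUpTo? (smallCase? p) (suc p)) 64} _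

balanced⇒exceptional : ∀ p k → 1 ≤ k → 2 ℕ.* k < suc p → Balanced (kernel (suc p) k) → Exceptional (suc p) k
balanced⇒exceptional p k 1≤k 2k<n balanced with p <? 64
... | yes p<64 = fromInj₁ (contradiction balanced) (small-cases p<64 (2*k<n⇒k<n 2k<n) 1≤k 2k<n)
... | no p≮64 = contradiction balanced (large-unbalanced (suc p) k (s≤s (ℕ.≮⇒≥ p≮64)))

theorem2 : (n k : ℕ) → 3 ≤ n → 1 ≤ k → 2 ℕ.* k < n →
    (ℓ : ℕ) → Is1Cycle8Regular n k ℓ →
    DPIso n k 5 2 ⊎ DPIso n k 10 2
theorem2 (suc p) k 3≤n 1≤k 2k<n ℓ regular =
  exceptional⇒DPIso (balanced⇒exceptional p k 1≤k 2k<n (Projection.regular⇒balanced (suc p) k 3≤n 1≤k 2k<n regular))
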